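{- For all integers $c\ge 1$ and $n\ge 2$, $$\frac{1}{c+2}\cdot\frac{(n+c)!}{c!}\le \gamma(cDB^+(n+c,n,n))\le \frac{(n+c-1)(n+c-1)!}{(c+1)!},$$ and the upper bound equals $\bigl(1+\Theta(1/c)\bigr)\frac{1}{c+2}\cdot\frac{(n+c)!}{c!}$.
   Context: Let $[d]=\{1,\dots,d\}$. A sequence $(x_1,\dots,x_n)\in[d]^n$ is $t$-constrained if for all $1\le i<j\le n$ with $x_i=x_j$ one has $j-i\ge t$; so $V(n+c,n,n)$ is the set of sequences of $n$ pairwise distinct symbols from $[n+c]$. The directed graph $cDB^+(d,t,n)$ has vertex set $V(d,t,n)$ (the $t$-constrained sequences in $[d]^n$) and an arc from $(a_1,\dots,a_n)$ to $(a_2,\dots,a_n,a_{n+1})$ whenever both lie in $V(d,t,n)$. In a directed graph a vertex dominates itself and its out-neighbours; a dominating set is a set $S$ of vertices such that every vertex is dominated by some vertex of $S$, and $\gamma(G)$ is the minimum size of a dominating set. -}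

module Defs where

open import Data.Nat using (ℕ; zero; suc; _+_; _*_; _∸_; _≤_; _<_; _!)
open import Data.Fin using (Fin; toℕ)
open import Data.Vec using (Vec; lookup; _∷_; _∷ʳ_)
open import Data.List using (List; length)
open import Data.List.Relation.Unary.All using (All)
open import Data.List.Relation.Unary.Any using (Any)
open import Data.List.Relation.Unary.Unique.Propositional using (Unique)
open import Data.Product using (Σ; ∃; _×_)
open import Data.Sum using (_⊎_)
open import Relation.Binary.PropositionalEquality using (_≡_)

Seq : ℕ → ℕ → Set
Seq d n = Vec (Fin d) n

Constrained : {d n : ℕ} → ℕ → Seq d n → Set
Constrained {d} {n} t xs =
  (i j : Fin n) → toℕ i < toℕ j → lookup xs i ≡ lookup xs j → t ≤ toℕ j ∸ toℕ i

Vertex : (d t n : ℕ) → Seq d n → Set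
Vertex d t n xs = Constrained t xs

-- Arc of cDB⁺(d,t,n) from (a_1,…,a_n) to (a_2,…,a_n,a_{n+1}),
-- both endpoints being vertices.  The shift is encoded as
-- u ∷ʳ b ≡ a ∷ v  (so u = a,a_2..a_n and v = a_2..a_n,b).
Arc : (d t n : ℕ) → Seq d n → Seq d n → Set
Arc d t n u v =
  Vertex d t n u × Vertex d t n v ×
  Σ (Fin d) (λ a → Σ (Fin d) (λ b → u ∷ʳ b ≡ a ∷ v))

Dominates : (d t n : ℕ) → Seq d n → Seq d n → Set
Dominates d t n s v = s ≡ v ⊎ Arc d t n s v

IsDominatingSet : (d t n : ℕ) → List (Seq d n) → Set
IsDominatingSet d t n S =
  Unique S × All (Vertex d t n) S ×
  ((v : Seq d n) → Vertex d t n v → Any (λ s → Dominates d t n s v) S)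

IsDominationNumber : (d t n : ℕ) → ℕ → Set
IsDominationNumber d t n m =
  Σ (List (Seq d n)) (λ S → IsDominatingSet d t n S × length S ≡ m) ×
  ((S : List (Seq d n)) → IsDominatingSet d t n S → m ≤ length S)

{-# OPTIONS --safe #-}
module Submission where

-- A vertex of cDB⁺(n + c, n, n) is a duplicate-free word s of length n.  Besides itself it
-- dominates only the words tail s ∷ʳ b with b one of the c + 1 letters missing from tail s,
-- so a dominating set needs at least |V| / (c + 2) = (n + c)! / ((c + 2) c!) words.
-- Conversely, take all words starting with 0 and, for every duplicate-free word u of length
-- n - 1 that contains 0 but does not start with it, one word a ∷ u with a ∉ u.  A word
-- v = u ∷ʳ b is then dominated by itself if it starts with 0, by 0 ∷ u if 0 ∉ u, and by a ∷ u
-- otherwise.  These are (n+c-1)!/c! + (n-2)(n+c-1)!/(c+1)! = (n+c-1)(n+c-1)!/(c+1)! words.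
-- The domination number exists since dominating sets of each size can be searched exhaustively.

open import Defs
open import Data.Nat using (ℕ; zero; suc; _+_; _*_; _∸_; _≤_; _<_; _!; z≤n; s≤s; _≤?_; _<?_)
open import Data.Nat.Properties
open import Data.Nat.Tactic.RingSolver using (solve-∀)
open import Data.Fin using (Fin; zero; suc; toℕ; punchIn; punchOut)
import Data.Fin.Properties as Finₚ
open import Data.Vec as Vec
  using (Vec; []; _∷_; _∷ʳ_; lookup; insertAt; initLast; toList; fromList)
import Data.Vec.Properties as Vecₚ
open import Data.Vec.Relation.Unary.All as Allᵥ using ([]; _∷_) renaming (All to Allᵥ)
open import Data.Vec.Relation.Unary.AllPairs using ([]; _∷_)
import Data.Vec.Relation.Unary.All.Properties as Allᵥₚ
import Data.Vec.Relation.Unary.Any as Anyᵥ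
import Data.Vec.Relation.Unary.Any.Properties as Anyᵥₚ
open import Data.Vec.Relation.Unary.Unique.Propositional using () renaming (Unique to Uniqueᵥ)
import Data.Vec.Relation.Unary.Unique.Propositional.Properties as Uniqueᵥₚ
open import Data.Vec.Membership.Propositional using () renaming (_∈_ to _∈ᵥ_; _∉_ to _∉ᵥ_)
open import Data.Vec.Membership.Propositional.Properties using (∈-toList⁻)
open import Data.List as List
  using (List; []; _∷_; [_]; _++_; length; concatMap; allFin; filter; deduplicate)
import Data.List.Properties as Listₚ
open import Data.List.Relation.Unary.All as All using (All; []; _∷_)
import Data.List.Relation.Unary.All.Properties as Allₚ
open import Data.List.Relation.Unary.Any as Any using (Any; here; there; _─_)
import Data.List.Relation.Unary.Any.Properties as Anyₚ
open import Data.List.Relation.Unary.AllPairs as AllPairs using ([]; _∷_)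
import Data.List.Relation.Unary.AllPairs.Properties as AllPairsₚ
open import Data.List.Relation.Unary.Unique.Propositional using (Unique)
import Data.List.Relation.Unary.Unique.Propositional.Properties as Uniqueₚ
import Data.List.Relation.Unary.Unique.DecPropositional as Uniqueᵈ
import Data.List.Relation.Unary.Unique.DecPropositional.Properties as Uniqueᵈₚ
open import Data.List.Relation.Binary.Subset.Propositional using (_⊆_)
open import Data.List.Relation.Binary.Disjoint.Propositional using (Disjoint)
open import Data.List.Membership.Propositional using (_∈_; lose)
open import Data.List.Membership.Propositional.Properties
  using (∈-concatMap⁺; ∈-concatMap⁻; ∈-map⁺; ∈-map⁻; ∈-++⁺ˡ; ∈-++⁺ʳ; ∈-allFin; ∈-filter⁺; ∈-filter⁻)
open import Data.Product using (Σ; ∃; _×_; _,_; proj₁; proj₂)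
open import Data.Sum using (inj₁; inj₂)
open import Function using (_∘_; id)
open import Relation.Nullary using (Dec; yes; no; contradiction)
open import Relation.Nullary.Decidable using (map′; ¬?; _×-dec_; _⊎-dec_; _→-dec_; decidable-stable)
open import Relation.Unary using (Decidable)
open import Relation.Binary.Definitions using (DecidableEquality)
open import Relation.Binary.PropositionalEquality hiding ([_])

private
  variable
    A B : Set
    k m K : ℕ

∈-─ : ∀ {x y} {ys : List A} (x∈ys : x ∈ ys) → y ∈ ys → y ≢ x → y ∈ (ys ─ x∈ys)
∈-─ (here refl)  (here refl)  y≢x = contradiction refl y≢x
∈-─ (here _)     (there y∈ys) _   = y∈ys
∈-─ (there _)    (here refl)  _   = here refl
∈-─ (there x∈ys) (there y∈ys) y≢x = there (∈-─ x∈ys y∈ys y≢x)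

unique⊆⇒length≤ : ∀ {xs ys : List A} → Unique xs → xs ⊆ ys → length xs ≤ length ys
unique⊆⇒length≤ {xs = []} _ _ = z≤n
unique⊆⇒length≤ {xs = x ∷ xs} {ys} (x∉xs ∷ xs!) xs⊆ys = begin
  suc (length xs)               ≤⟨ s≤s (unique⊆⇒length≤ xs! xs⊆ys─x) ⟩
  suc (length (ys ─ x∈ys))      ≡⟨ Listₚ.length-removeAt′ ys (Any.index x∈ys) ⟨
  length ys                     ∎
  where
  open ≤-Reasoning
  x∈ys : x ∈ ys
  x∈ys = xs⊆ys (here refl)
  xs⊆ys─x : xs ⊆ (ys ─ x∈ys)
  xs⊆ys─x y∈xs = ∈-─ x∈ys (xs⊆ys (there y∈xs)) (All.lookup x∉xs y∈xs ∘ sym)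

length-concatMap : (f : A → List B) (xs : List A) → (∀ x → length (f x) ≡ K) →
                   length (concatMap f xs) ≡ length xs * K
length-concatMap f []       _ = refl
length-concatMap f (x ∷ xs) fK =
  trans (Listₚ.length-++ (f x)) (cong₂ _+_ (fK x) (length-concatMap f xs fK))

length-concatMap≤ : (f : A → List B) (xs : List A) → (∀ {x} → x ∈ xs → length (f x) ≤ K) →
                    length (concatMap f xs) ≤ length xs * K
length-concatMap≤ f []       _ = z≤n
length-concatMap≤ f (x ∷ xs) f≤K = ≤-trans (≤-reflexive (Listₚ.length-++ (f x)))
  (+-mono-≤ (f≤K (here refl)) (length-concatMap≤ f xs (f≤K ∘ there)))

length≤-covered : ∀ {xs : List A} {S : List B} (f : B → List A) → Unique xs →
                  (∀ {x} → x ∈ xs → Any (λ s → x ∈ f s) S) →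
                  (∀ {s} → s ∈ S → length (f s) ≤ K) → length xs ≤ length S * K
length≤-covered f xs! covered f≤K =
  ≤-trans (unique⊆⇒length≤ xs! (∈-concatMap⁺ f ∘ covered)) (length-concatMap≤ f _ f≤K)

module _ {P : A → Set} where

  Allᵥ-∷ʳ⁻ : ∀ {x} {xs : Vec A k} → Allᵥ P (xs ∷ʳ x) → Allᵥ P xs × P x
  Allᵥ-∷ʳ⁻ {xs = []}     (px ∷ [])  = [] , px
  Allᵥ-∷ʳ⁻ {xs = y ∷ ys} (py ∷ pys) = let (pys′ , px) = Allᵥ-∷ʳ⁻ pys in (py ∷ pys′) , px

  Allᵥ-insertAt⁺ : ∀ {x} {xs : Vec A k} i → P x → Allᵥ P xs → Allᵥ P (insertAt xs i x)
  Allᵥ-insertAt⁺ zero    px pxs        = px ∷ pxs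
  Allᵥ-insertAt⁺ (suc i) px (py ∷ pys) = py ∷ Allᵥ-insertAt⁺ i px pys

  Allᵥ-insertAt⁻ : ∀ {x} {xs : Vec A k} i → Allᵥ P (insertAt xs i x) → P x × Allᵥ P xs
  Allᵥ-insertAt⁻              zero    (px ∷ pxs) = px , pxs
  Allᵥ-insertAt⁻ {xs = _ ∷ _} (suc i) (py ∷ pys) = let (px , pys′) = Allᵥ-insertAt⁻ i pys in px , (py ∷ pys′)

∉ᵥ⇒All≢ : ∀ {x} {xs : Vec A k} → x ∉ᵥ xs → Allᵥ (x ≢_) xs
∉ᵥ⇒All≢ {xs = []}     _    = []
∉ᵥ⇒All≢ {xs = y ∷ ys} x∉xs = (x∉xs ∘ Anyᵥ.here) ∷ ∉ᵥ⇒All≢ (x∉xs ∘ Anyᵥ.there)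

unique-∷ʳ⁻ : ∀ {x} {xs : Vec A k} → Uniqueᵥ (xs ∷ʳ x) → Uniqueᵥ xs × x ∉ᵥ xs
unique-∷ʳ⁻ {xs = []}     _            = [] , λ ()
unique-∷ʳ⁻ {xs = y ∷ ys} (y∉ys ∷ ys!) with Allᵥ-∷ʳ⁻ y∉ys | unique-∷ʳ⁻ ys!
... | y∉ys′ , y≢x | ys!′ , x∉ys = (y∉ys′ ∷ ys!′) , λ
  { (Anyᵥ.here x≡y)    → y≢x (sym x≡y)
  ; (Anyᵥ.there x∈ys) → x∉ys x∈ys }

unique-insertAt⁺ : ∀ {x} {xs : Vec A k} i → Allᵥ (x ≢_) xs → Uniqueᵥ xs → Uniqueᵥ (insertAt xs i x)
unique-insertAt⁺ zero    x∉xs xs! = x∉xs ∷ xs!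
unique-insertAt⁺ (suc i) (x≢y ∷ x∉ys) (y∉ys ∷ ys!) =
  Allᵥ-insertAt⁺ i (x≢y ∘ sym) y∉ys ∷ unique-insertAt⁺ i x∉ys ys!

unique-insertAt⁻ : ∀ {x} {xs : Vec A k} i → Uniqueᵥ (insertAt xs i x) → Allᵥ (x ≢_) xs × Uniqueᵥ xs
unique-insertAt⁻              zero    (x∉xs ∷ xs!) = x∉xs , xs!
unique-insertAt⁻ {xs = _ ∷ _} (suc i) (y∉ ∷ xs!) with Allᵥ-insertAt⁻ i y∉ | unique-insertAt⁻ i xs!
... | y≢x , y∉ys | x∉ys , ys! = ((y≢x ∘ sym) ∷ x∉ys) , (y∉ys ∷ ys!)

module _ {f : A → B} where

  unique-map⁻ : {xs : Vec A k} → Uniqueᵥ (Vec.map f xs) → Uniqueᵥ xs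
  unique-map⁻ {xs = []}     _              = []
  unique-map⁻ {xs = x ∷ xs} (fx∉fxs ∷ fxs!) =
    Allᵥ.map (λ fx≢fy x≡y → fx≢fy (cong f x≡y)) (Allᵥₚ.map⁻ fx∉fxs) ∷ unique-map⁻ fxs!

  map-injective : (∀ {x y} → f x ≡ f y → x ≡ y) → {xs ys : Vec A k} → Vec.map f xs ≡ Vec.map f ys → xs ≡ ys
  map-injective f-inj {[]}     {[]}     _  = refl
  map-injective f-inj {x ∷ xs} {y ∷ ys} eq =
    cong₂ _∷_ (f-inj (Vecₚ.∷-injectiveˡ eq)) (map-injective f-inj (Vecₚ.∷-injectiveʳ eq))

All≢⇒map-punchIn : ∀ {m} {x : Fin (suc m)} {xs : Vec (Fin (suc m)) k} →
                   Allᵥ (x ≢_) xs → ∃ λ ws → Vec.map (punchIn x) ws ≡ xs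
All≢⇒map-punchIn []             = [] , refl
All≢⇒map-punchIn (x≢y ∷ x∉ys) =
  let (ws , eq) = All≢⇒map-punchIn x∉ys in punchOut x≢y ∷ ws , cong₂ _∷_ (Finₚ.punchIn-punchOut x≢y) eq

_∈ᵥ?_ : (a : Fin m) (xs : Vec (Fin m) k) → Dec (a ∈ᵥ xs)
a ∈ᵥ? xs = Anyᵥ.any? (a Finₚ.≟_) xs

_∉ᵥ?_ : (a : Fin m) (xs : Vec (Fin m) k) → Dec (a ∉ᵥ xs)
a ∉ᵥ? xs = ¬? (a ∈ᵥ? xs)

-- If every letter occurred in xs, sending it to one of its positions would inject Fin m into Fin k.
fresh : (xs : Vec (Fin m) k) → k < m → ∃ λ a → a ∉ᵥ xs
fresh xs k<m with Finₚ.any? (_∉ᵥ? xs)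
... | yes a∉xs = a∉xs
... | no ∄a∉xs = contradiction (Finₚ.injective⇒≤ index-injective) (<⇒≱ k<m)
  where
  mem : ∀ a → a ∈ᵥ xs
  mem a = decidable-stable (a ∈ᵥ? xs) (λ a∉xs → ∄a∉xs (a , a∉xs))
  index-injective : ∀ {a b} → Anyᵥ.index (mem a) ≡ Anyᵥ.index (mem b) → a ≡ b
  index-injective {a} {b} eq =
    trans (Anyᵥₚ.lookup-index (mem a)) (trans (cong (lookup xs) eq) (sym (Anyᵥₚ.lookup-index (mem b))))

unique⇒constrained : ∀ {d n} t {xs : Seq d n} → Uniqueᵥ xs → Constrained t xs
unique⇒constrained t xs! i j i<j eq = contradiction (cong toℕ (Uniqueᵥₚ.lookup-injective xs! i j eq)) (<⇒≢ i<j)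

constrained⇒unique : ∀ {d n t} {xs : Seq d n} → n ≤ t → Constrained t xs → Uniqueᵥ xs
constrained⇒unique {xs = []}     _   _ = []
constrained⇒unique {xs = x ∷ xs} n≤t xs-constrained =
  Allᵥₚ.lookup⁻ (λ j x≡xⱼ → <⇒≱ (≤-trans (s≤s (Finₚ.toℕ<n j)) n≤t)
                                 (xs-constrained zero (suc j) (s≤s z≤n) x≡xⱼ)) ∷
  constrained⇒unique (≤-trans (n≤1+n _) n≤t) (λ i j i<j → xs-constrained (suc i) (suc j) (s≤s i<j))

vertex⇒unique : ∀ {d n} {xs : Seq d n} → Vertex d n n xs → Uniqueᵥ xs
vertex⇒unique = constrained⇒unique ≤-refl

unique⇒vertex : ∀ {d n} {xs : Seq d n} → Uniqueᵥ xs → Vertex d n n xs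
unique⇒vertex {n = n} = unique⇒constrained n

_≟ₛ_ : ∀ {d n} → DecidableEquality (Seq d n)
_≟ₛ_ = Vecₚ.≡-dec Finₚ._≟_

-- Arrangements

mutual
  arrangements : (m k : ℕ) → List (Vec (Fin m) k)
  arrangements m       zero    = [ [] ]
  arrangements zero    (suc k) = []
  arrangements (suc m) (suc k) = concatMap (arrangementsWith zero) (allFin (suc m))

  arrangementsWith : Fin (suc k) → Fin (suc m) → List (Vec (Fin (suc m)) (suc k))
  arrangementsWith {k} {m} i x = List.map (λ ws → insertAt (Vec.map (punchIn x) ws) i x) (arrangements m k)

lookup-∈-arrangementsWith : ∀ (i : Fin (suc k)) {x : Fin (suc m)} {v} →
                            v ∈ arrangementsWith i x → lookup v i ≡ x
lookup-∈-arrangementsWith i {x} v∈ with ∈-map⁻ _ v∈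
... | ws , _ , refl = Vecₚ.insertAt-lookup (Vec.map (punchIn x) ws) i x

mutual
  ∈-arrangements⇒unique : ∀ {v : Vec (Fin m) k} → v ∈ arrangements m k → Uniqueᵥ v
  ∈-arrangements⇒unique {k = zero}          (here refl) = []
  ∈-arrangements⇒unique {suc m} {suc k} v∈ =
    let (_ , v∈′) = Any.satisfied (∈-concatMap⁻ (arrangementsWith zero) {xs = allFin (suc m)} v∈)
    in ∈-arrangementsWith⇒unique zero v∈′

  ∈-arrangementsWith⇒unique : ∀ (i : Fin (suc k)) {x : Fin (suc m)} {v} →
                              v ∈ arrangementsWith i x → Uniqueᵥ v
  ∈-arrangementsWith⇒unique i {x} v∈ with ∈-map⁻ _ v∈
  ... | ws , ws∈ , refl = unique-insertAt⁺ i
    (Allᵥₚ.map⁺ (Allᵥ.universal (λ w → Finₚ.punchInᵢ≢i x w ∘ sym) ws))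
    (Uniqueᵥₚ.map⁺ (Finₚ.punchIn-injective x _ _) (∈-arrangements⇒unique ws∈))

mutual
  unique⇒∈-arrangements : ∀ {v : Vec (Fin m) k} → Uniqueᵥ v → v ∈ arrangements m k
  unique⇒∈-arrangements {k = zero}  {v = []}     _ = here refl
  unique⇒∈-arrangements {suc m} {suc k} {x ∷ v} v! =
    ∈-concatMap⁺ (arrangementsWith zero) (lose (∈-allFin x) (unique⇒∈-arrangementsWith zero v! refl))

  insertAt-∈-arrangementsWith : ∀ (i : Fin (suc k)) {x : Fin (suc m)} {r} →
                                Allᵥ (x ≢_) r → Uniqueᵥ r → insertAt r i x ∈ arrangementsWith i x
  insertAt-∈-arrangementsWith i x∉r r! with All≢⇒map-punchIn x∉r
  ... | ws , refl = ∈-map⁺ _ (unique⇒∈-arrangements (unique-map⁻ r!))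

  unique⇒∈-arrangementsWith : ∀ (i : Fin (suc k)) {x : Fin (suc m)} {v} →
                              Uniqueᵥ v → lookup v i ≡ x → v ∈ arrangementsWith i x
  unique⇒∈-arrangementsWith i {v = v} v! refl
    with unique-insertAt⁻ i (subst Uniqueᵥ (sym (Vecₚ.insertAt-removeAt v i)) v!)
  ... | x∉r , r! = subst (_∈ arrangementsWith i (lookup v i)) (Vecₚ.insertAt-removeAt v i)
                     (insertAt-∈-arrangementsWith i x∉r r!)

arrangements-unique : ∀ m k → Unique (arrangements m k)
arrangements-unique m       zero    = [] ∷ []
arrangements-unique zero    (suc k) = []
arrangements-unique (suc m) (suc k) = Uniqueₚ.concat⁺
  (Allₚ.map⁺ (All.universal arrangementsWith-unique (allFin (suc m))))
  (AllPairsₚ.map⁺ (AllPairs.map arrangementsWith-disjoint (Uniqueₚ.allFin⁺ (suc m))))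
  where
  arrangementsWith-unique : ∀ x → Unique (arrangementsWith zero x)
  arrangementsWith-unique x = Uniqueₚ.map⁺ insert-injective (arrangements-unique m k)
    where
    insert-injective : ∀ {ws ws′} → x ∷ Vec.map (punchIn x) ws ≡ x ∷ Vec.map (punchIn x) ws′ → ws ≡ ws′
    insert-injective = map-injective (Finₚ.punchIn-injective x _ _) ∘ Vecₚ.∷-injectiveʳ
  arrangementsWith-disjoint : ∀ {x y} → x ≢ y → Disjoint (arrangementsWith zero x) (arrangementsWith zero y)
  arrangementsWith-disjoint x≢y (v∈x , v∈y) =
    x≢y (trans (sym (lookup-∈-arrangementsWith zero v∈x)) (lookup-∈-arrangementsWith zero v∈y))

length-arrangements-suc : ∀ m k → length (arrangements (suc m) (suc k)) ≡ suc m * length (arrangements m k)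
length-arrangements-suc m k = begin
  length (concatMap (arrangementsWith {k} zero) (allFin (suc m)))
    ≡⟨ length-concatMap (arrangementsWith {k} zero) (allFin (suc m)) length-with ⟩
  length (allFin (suc m)) * length (arrangements m k)
    ≡⟨ cong (_* length (arrangements m k)) (Listₚ.length-tabulate {n = suc m} id) ⟩
  suc m * length (arrangements m k)
    ∎
  where
  open ≡-Reasoning
  length-with : ∀ x → length (arrangementsWith {k} zero x) ≡ length (arrangements m k)
  length-with _ = Listₚ.length-map _ (arrangements m k)

length-arrangements : ∀ k c → length (arrangements (k + c) k) * c ! ≡ (k + c) !
length-arrangements zero    c = +-identityʳ (c !)
length-arrangements (suc k) c = begin
  length (arrangements (suc k + c) (suc k)) * c !        ≡⟨ cong (_* c !) (length-arrangements-suc (k + c) k) ⟩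
  suc (k + c) * length (arrangements (k + c) k) * c !    ≡⟨ *-assoc (suc (k + c)) (length (arrangements (k + c) k)) (c !) ⟩
  suc (k + c) * (length (arrangements (k + c) k) * c !)  ≡⟨ cong (suc (k + c) *_) (length-arrangements k c) ⟩
  suc (k + c) !                                          ∎
  where open ≡-Reasoning

private
  rearrange : ∀ s c f → s * (2 + c) * f ≡ (c + 2) * f * s
  rearrange = solve-∀

  distribute : ∀ c f a b p → (1 + c) * f * (a + p * b) ≡ (1 + c) * (a * f) + p * (b * ((1 + c) * f))
  distribute = solve-∀

  collect : ∀ c p x → (1 + c) * x + p * x ≡ (1 + (p + c)) * x
  collect = solve-∀

  regroup : ∀ c m f g → c * (c + 2) * f * (m * g) ≡ c * (c + 2) * m * (f * g)
  regroup = solve-∀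

  regroup′ : ∀ c m f g → (c + 1) * (c + 1) * (1 + m) * (f * g) ≡ (c + 1) * ((1 + c) * f * ((1 + m) * g))
  regroup′ = solve-∀

  square : ∀ c → 1 + c * (c + 2) ≡ (c + 1) * (c + 1)
  square = solve-∀

upper≤[1+1/c]lower : ∀ c m → c * (c + 2) * c ! * (m * m !) ≤ (c + 1) * (suc c ! * suc m !)
upper≤[1+1/c]lower c m = begin
  c * (c + 2) * c ! * (m * m !)            ≡⟨ regroup c m (c !) (m !) ⟩
  c * (c + 2) * m * (c ! * m !)            ≤⟨ *-monoˡ-≤ (c ! * m !) (*-mono-≤ c[c+2]≤[c+1]² (n≤1+n m)) ⟩
  (c + 1) * (c + 1) * suc m * (c ! * m !)  ≡⟨ regroup′ c m (c !) (m !) ⟩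
  (c + 1) * (suc c ! * suc m !)            ∎
  where
  open ≤-Reasoning
  c[c+2]≤[c+1]² : c * (c + 2) ≤ (c + 1) * (c + 1)
  c[c+2]≤[c+1]² = ≤-trans (n≤1+n _) (≤-reflexive (square c))

-- Lower bound

unique-toList : {xs : Vec A k} → Uniqueᵥ xs → Unique (toList xs)
unique-toList []            = []
unique-toList (x∉xs ∷ xs!) = Allᵥₚ.toList⁺ x∉xs ∷ unique-toList xs!

freshLetters : Vec (Fin m) k → List (Fin m)
freshLetters xs = filter (_∉ᵥ? xs) (allFin _)

length-freshLetters : {xs : Vec (Fin m) k} → Uniqueᵥ xs → length (freshLetters xs) + k ≤ m
length-freshLetters {m} {k} {xs} xs! = begin
  length (freshLetters xs) + k                   ≡⟨ cong (length (freshLetters xs) +_) (Vecₚ.length-toList xs) ⟨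
  length (freshLetters xs) + length (toList xs)  ≡⟨ Listₚ.length-++ (freshLetters xs) ⟨
  length (freshLetters xs ++ toList xs)          ≤⟨ unique⊆⇒length≤ fresh++xs! (λ {a} _ → ∈-allFin a) ⟩
  length (allFin m)                              ≡⟨ Listₚ.length-tabulate id ⟩
  m                                              ∎
  where
  open ≤-Reasoning
  fresh++xs! : Unique (freshLetters xs ++ toList xs)
  fresh++xs! = Uniqueₚ.++⁺ (Uniqueₚ.filter⁺ (_∉ᵥ? xs) (Uniqueₚ.allFin⁺ m)) (unique-toList xs!)
    λ (a∈fresh , a∈xs) → proj₂ (∈-filter⁻ (_∉ᵥ? xs) {xs = allFin m} a∈fresh) (∈-toList⁻ a∈xs)

closedNeighbourhood : Seq m (suc k) → List (Seq m (suc k))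
closedNeighbourhood s = s ∷ List.map (Vec.tail s ∷ʳ_) (freshLetters (Vec.tail s))

dominates⇒∈-closedNeighbourhood : {s v : Seq m (suc k)} →
  Dominates m (suc k) (suc k) s v → v ∈ closedNeighbourhood s
dominates⇒∈-closedNeighbourhood (inj₁ refl) = here refl
dominates⇒∈-closedNeighbourhood {s = _ ∷ st} (inj₂ (_ , v-vertex , _ , b , eq))
  with Vecₚ.∷-injectiveʳ eq
... | refl = there (∈-map⁺ _ (∈-filter⁺ _ (∈-allFin b) (proj₂ (unique-∷ʳ⁻ (vertex⇒unique v-vertex)))))

length-closedNeighbourhood : {s : Seq m (suc k)} →
  Vertex m (suc k) (suc k) s → length (closedNeighbourhood s) + k ≤ suc m
length-closedNeighbourhood {s = s₀ ∷ st} s-vertex with vertex⇒unique {xs = s₀ ∷ st} s-vertex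
... | _ ∷ st! =
  s≤s (subst (λ l → l + _ ≤ _) (sym (Listₚ.length-map _ (freshLetters st))) (length-freshLetters st!))

length-arrangements≤ : ∀ {k c S} → IsDominatingSet (suc k + c) (suc k) (suc k) S →
                       length (arrangements (suc k + c) (suc k)) ≤ length S * (2 + c)
length-arrangements≤ {k} {c} (_ , S-vertices , dominated) =
  length≤-covered closedNeighbourhood (arrangements-unique _ _) covered bounded
  where
  covered : ∀ {v} → v ∈ arrangements (suc k + c) (suc k) → Any (λ s → v ∈ closedNeighbourhood s) _
  covered {v} v∈ = Any.map dominates⇒∈-closedNeighbourhood
                     (dominated v (unique⇒vertex (∈-arrangements⇒unique v∈)))
  bounded : ∀ {s} → s ∈ _ → length (closedNeighbourhood s) ≤ 2 + c
  bounded {s} s∈S = +-cancelʳ-≤ k _ _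
    (≤-trans (length-closedNeighbourhood {s = s} (All.lookup S-vertices s∈S)) (≤-reflexive (cong (2 +_) (+-comm k c))))

domination-lowerBound : ∀ {k c S} → IsDominatingSet (suc k + c) (suc k) (suc k) S →
                        (suc k + c) ! ≤ (c + 2) * c ! * length S
domination-lowerBound {k} {c} {S} S-dominating = begin
  (suc k + c) !                                         ≡⟨ length-arrangements (suc k) c ⟨
  length (arrangements (suc k + c) (suc k)) * c !      ≤⟨ *-monoˡ-≤ (c !) (length-arrangements≤ S-dominating) ⟩
  length S * (2 + c) * c !                             ≡⟨ rearrange (length S) c (c !) ⟩
  (c + 2) * c ! * length S                             ∎
  where open ≤-Reasoning

-- Upper bound

arc-∷-∷ʳ : ∀ {d t n a b} {u : Vec (Fin d) n} →
           Vertex d t (suc n) (a ∷ u) → Vertex d t (suc n) (u ∷ʳ b) → Arc d t (suc n) (a ∷ u) (u ∷ʳ b)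
arc-∷-∷ʳ {a = a} {b} s-vertex v-vertex = s-vertex , v-vertex , a , b , refl

deduplicate-isDominatingSet : ∀ {d t n} {S : List (Seq d n)} → All (Vertex d t n) S →
  (∀ v → Vertex d t n v → Any (λ s → Dominates d t n s v) S) →
  IsDominatingSet d t n (deduplicate _≟ₛ_ S)
deduplicate-isDominatingSet {S = S} S-vertices S-dominates =
  Uniqueᵈₚ.deduplicate-! _≟ₛ_ S ,
  Allₚ.deduplicate⁺ _ S-vertices ,
  λ v v-vertex → Anyₚ.deduplicate⁺ _ (λ { refl dom → dom }) (S-dominates v v-vertex)

module UpperBound (p c : ℕ) where

  M : ℕ
  M = suc (p + c)

  startingWithZero : List (Seq (suc M) (2 + p))
  startingWithZero = arrangementsWith zero zero

  zeroInside : List (Vec (Fin (suc M)) (suc p))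
  zeroInside = concatMap (λ i → arrangementsWith (suc i) zero) (allFin p)

  freshFor : (u : Vec (Fin (suc M)) (suc p)) → ∃ λ a → a ∉ᵥ u
  freshFor u = fresh u (s≤s (s≤s (m≤m+n p c)))

  extend : Vec (Fin (suc M)) (suc p) → Seq (suc M) (2 + p)
  extend u = proj₁ (freshFor u) ∷ u

  candidates : List (Seq (suc M) (2 + p))
  candidates = startingWithZero ++ List.map extend zeroInside

  ∈-zeroInside⇒unique : ∀ {u} → u ∈ zeroInside → Uniqueᵥ u
  ∈-zeroInside⇒unique u∈ =
    let (i , u∈′) = Any.satisfied (∈-concatMap⁻ _ {xs = allFin p} u∈) in ∈-arrangementsWith⇒unique (suc i) u∈′

  extend-unique : ∀ {u} → Uniqueᵥ u → Uniqueᵥ (extend u)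
  extend-unique {u} u! = ∉ᵥ⇒All≢ (proj₂ (freshFor u)) ∷ u!

  candidates-vertices : All (Vertex (suc M) (2 + p) (2 + p)) candidates
  candidates-vertices = Allₚ.++⁺
    (All.tabulate (unique⇒vertex ∘ ∈-arrangementsWith⇒unique zero))
    (Allₚ.map⁺ (All.tabulate (unique⇒vertex ∘ extend-unique ∘ ∈-zeroInside⇒unique)))

  candidates-dominate-∷ʳ : ∀ u b → Uniqueᵥ (u ∷ʳ b) →
    Any (λ s → Dominates (suc M) (2 + p) (2 + p) s (u ∷ʳ b)) candidates
  candidates-dominate-∷ʳ (u₀ ∷ u′) b v! with u₀ Finₚ.≟ zero | zero ∈ᵥ? (u₀ ∷ u′)
  ... | yes refl | _ = lose (∈-++⁺ˡ (unique⇒∈-arrangementsWith zero v! refl)) (inj₁ refl)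
  ... | no _ | no 0∉u = lose (∈-++⁺ˡ (unique⇒∈-arrangementsWith zero 0∷u! refl))
                             (inj₂ (arc-∷-∷ʳ (unique⇒vertex 0∷u!) (unique⇒vertex v!)))
    where
    0∷u! : Uniqueᵥ (zero ∷ u₀ ∷ u′)
    0∷u! = ∉ᵥ⇒All≢ 0∉u ∷ proj₁ (unique-∷ʳ⁻ v!)
  ... | no u₀≢0 | yes (Anyᵥ.here 0≡u₀) = contradiction (sym 0≡u₀) u₀≢0
  ... | no _ | yes (Anyᵥ.there 0∈u′) =
    lose (∈-++⁺ʳ startingWithZero (∈-map⁺ extend u∈zeroInside))
         (inj₂ (arc-∷-∷ʳ (unique⇒vertex (extend-unique u!)) (unique⇒vertex v!)))
    where
    u! : Uniqueᵥ (u₀ ∷ u′)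
    u! = proj₁ (unique-∷ʳ⁻ v!)
    u∈zeroInside : u₀ ∷ u′ ∈ zeroInside
    u∈zeroInside = ∈-concatMap⁺ _ (lose (∈-allFin (Anyᵥ.index 0∈u′))
      (unique⇒∈-arrangementsWith (suc (Anyᵥ.index 0∈u′)) u! (sym (Anyᵥₚ.lookup-index 0∈u′))))

  candidates-dominate : ∀ v → Vertex (suc M) (2 + p) (2 + p) v →
    Any (λ s → Dominates (suc M) (2 + p) (2 + p) s v) candidates
  candidates-dominate v v-vertex with initLast v
  ... | u , b , refl = candidates-dominate-∷ʳ u b (vertex⇒unique v-vertex)

  -- The candidates are in fact distinct; deduplicating spares us the proof.
  dominatingSet : List (Seq (suc M) (2 + p))
  dominatingSet = deduplicate _≟ₛ_ candidates

  dominatingSet-isDominatingSet : IsDominatingSet (suc M) (2 + p) (2 + p) dominatingSet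
  dominatingSet-isDominatingSet = deduplicate-isDominatingSet candidates-vertices candidates-dominate

  length-candidates : length candidates ≡ length (arrangements M (suc p)) + p * length (arrangements M p)
  length-candidates = begin
    length (startingWithZero ++ List.map extend zeroInside)
      ≡⟨ Listₚ.length-++ startingWithZero ⟩
    length startingWithZero + length (List.map extend zeroInside)
      ≡⟨ cong₂ _+_ (Listₚ.length-map _ (arrangements M (suc p))) (Listₚ.length-map extend zeroInside) ⟩
    length (arrangements M (suc p)) + length zeroInside
      ≡⟨ cong (length (arrangements M (suc p)) +_) length-zeroInside ⟩
    length (arrangements M (suc p)) + p * length (arrangements M p)
      ∎
    where
    open ≡-Reasoning
    length-zeroInside : length zeroInside ≡ p * length (arrangements M p)
    length-zeroInside =
      trans (length-concatMap _ (allFin p) (λ _ → Listₚ.length-map _ (arrangements M p)))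
            (cong (_* length (arrangements M p)) (Listₚ.length-tabulate {n = p} id))

  length-dominatingSet : suc c ! * length dominatingSet ≤ M * M !
  length-dominatingSet = begin
    suc c ! * length dominatingSet           ≤⟨ *-monoʳ-≤ (suc c !) (Listₚ.length-deduplicate _ candidates) ⟩
    suc c ! * length candidates              ≡⟨ cong (suc c ! *_) length-candidates ⟩
    suc c ! * (#₁ + p * #₂)                  ≡⟨ distribute c (c !) #₁ #₂ p ⟩
    suc c * (#₁ * c !) + p * (#₂ * suc c !)  ≡⟨ cong₂ (λ x y → suc c * x + p * y) #₁-count #₂-count ⟩
    suc c * M ! + p * M !                    ≡⟨ collect c p (M !) ⟩
    M * M !                                  ∎
    where
    open ≤-Reasoning
    #₁ #₂ : ℕ
    #₁ = length (arrangements M (suc p))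
    #₂ = length (arrangements M p)
    #₁-count : #₁ * c ! ≡ M !
    #₁-count = length-arrangements (suc p) c
    #₂-count : #₂ * suc c ! ≡ M !
    #₂-count = subst (λ m → length (arrangements m p) * suc c ! ≡ m !) (+-suc p c) (length-arrangements p (suc c))

-- Existence of the domination number

Searchable : Set → Set₁
Searchable A = ∀ {P : A → Set} → Decidable P → Dec (∃ P)

searchable-Vec : Searchable A → ∀ k → Searchable (Vec A k)
searchable-Vec search zero    P? = map′ ([] ,_) (λ { ([] , p) → p }) (P? [])
searchable-Vec search (suc k) P? =
  map′ (λ (x , xs , p) → x ∷ xs , p) (λ { (x ∷ xs , p) → x , xs , p })
       (search (λ x → searchable-Vec search k (λ xs → P? (x ∷ xs))))

∀? : Searchable A → {P : A → Set} → Decidable P → Dec (∀ x → P x)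
∀? search P? with search (¬? ∘ P?)
... | yes (x , ¬px) = no λ ∀P → ¬px (∀P x)
... | no ∄¬P       = yes λ x → decidable-stable (P? x) (λ ¬px → ∄¬P (x , ¬px))

least-witness : {P : ℕ → Set} → Decidable P → ∀ {n} → P n → ∃ λ m → P m × (∀ {k} → P k → m ≤ k)
least-witness P? {zero}  p₀ = 0 , p₀ , λ _ → z≤n
least-witness P? {suc n} pₙ with P? 0
... | yes p₀ = 0 , p₀ , λ _ → z≤n
... | no ¬p₀ with least-witness (P? ∘ suc) pₙ
...   | m , pm , least = suc m , pm , λ { {zero} p₀ → contradiction p₀ ¬p₀ ; {suc _} pk → s≤s (least pk) }

module _ {d t n : ℕ} where

  vertex? : Decidable (Vertex d t n)
  vertex? xs = Finₚ.all? λ i → Finₚ.all? λ j →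
    (toℕ i <? toℕ j) →-dec (lookup xs i Finₚ.≟ lookup xs j) →-dec (t ≤? toℕ j ∸ toℕ i)

  dominates? : ∀ s v → Dec (Dominates d t n s v)
  dominates? s v = (s ≟ₛ v) ⊎-dec (vertex? s ×-dec vertex? v ×-dec
    Finₚ.any? λ a → Finₚ.any? λ b → (s ∷ʳ b) ≟ₛ (a ∷ v))

  isDominatingSet? : Decidable (IsDominatingSet d t n)
  isDominatingSet? S = Uniqueᵈ.unique? _≟ₛ_ S ×-dec All.all? vertex? S ×-dec
    ∀? (searchable-Vec Finₚ.any? n) (λ v → vertex? v →-dec Any.any? (λ s → dominates? s v) S)

  dominatingSetOfSize? : Decidable (λ k → ∃ λ S → IsDominatingSet d t n S × length S ≡ k)
  dominatingSetOfSize? k =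
    map′ (λ (S , S-dom) → toList S , S-dom , Vecₚ.length-toList S)
         (λ { (S , S-dom , refl) →
              fromList S , subst (IsDominatingSet d t n) (sym (Vecₚ.toList∘fromList S)) S-dom })
         (searchable-Vec (searchable-Vec Finₚ.any? n) k (isDominatingSet? ∘ toList))

  dominationNumber : ∀ {S} → IsDominatingSet d t n S → ∃ (IsDominationNumber d t n)
  dominationNumber S-dom with least-witness dominatingSetOfSize? (_ , S-dom , refl)
  ... | γ , γ-attained , γ-least = γ , γ-attained , λ S S-dom → γ-least (S , S-dom , refl)

theorem13 : (c n : ℕ) → 1 ≤ c → 2 ≤ n →
    Σ ℕ (λ γ → IsDominationNumber (n + c) n n γ ×
      ((n + c) ! ≤ (c + 2) * c ! * γ) ×
      ((suc c) ! * γ ≤ (n + c ∸ 1) * (n + c ∸ 1) !) ×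
      (c * (c + 2) * c ! * ((n + c ∸ 1) * (n + c ∸ 1) !)
        ≤ (c + 1) * ((suc c) ! * (n + c) !)))
theorem13 c (suc (suc p)) _ (s≤s (s≤s _))
  with dominationNumber (UpperBound.dominatingSet-isDominatingSet p c)
... | γ , γ-number@((_ , S-dominating , refl) , γ-least) =
  γ , γ-number , domination-lowerBound S-dominating , upper , upper≤[1+1/c]lower c M
  where
  open UpperBound p c
  upper : suc c ! * γ ≤ M * M !
  upper = ≤-trans (*-monoʳ-≤ (suc c !) (γ-least dominatingSet dominatingSet-isDominatingSet)) length-dominatingSet
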